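{- Let $\mathcal{C}$ be a left $\Sigma$-additive category and let $(h_b)_{b\in B}$ be a summable family in $\mathcal{C}(Y,Z)$ such that every $h_b$ is $\Sigma$-additive. Then $\sum_{b\in B}h_b$ is $\Sigma$-additive.
   Context: A $\Sigma$-monoid is a nonempty set $M$ with a partial operation $\Sigma$ on families indexed by at most countable sets (families in its domain are called summable) satisfying: every one-element family $x$ is summable with sum $x$; and for every family $(x_a)_{a\in A}$ and every partition $(A_i)_{i\in I}$ of $A$ ($I$ at most countable, parts possibly empty), $\sum_{a\in A}x_a\simeq\sum_{i\in I}\sum_{a\in A_i}x_a$. Here $e\simeq e'$ means $e$ is defined iff $e'$ is and then they are equal, and $e\sqsubseteq e'$ means: whenever $e$ is defined, $e'$ is defined and $e=e'$. A left $\Sigma$-additive category is a category in which every hom-set is a $\Sigma$-monoid and $(\sum_{b\in B}g_b)\circ f\sqsubseteq\sum_{b\in B}(g_b\circ f)$ for all families $(g_b)$ in $\mathcal{C}(Y,Z)$ and all $f\in\mathcal{C}(X,Y)$. A morphism $h\in\mathcal{C}(Y,Z)$ is $\Sigma$-additive if $h\circ(\sum_{a\in A}f_a)\sqsubseteq\sum_{a\in A}(h\circ f_a)$ for every object $X$ and every family $(f_a)$ in $\mathcal{C}(X,Y)$. -}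

module Defs where

open import Level using (Level; _⊔_) renaming (suc to lsuc; zero to lzero)
open import Data.Nat using (ℕ)
open import Data.Product using (Σ; ∃; _×_; _,_; proj₁)
open import Function using (_⇔_)
open import Function.Definitions using (Injective)
open import Relation.Binary.PropositionalEquality using (_≡_)

IsCountable : Set → Set
IsCountable A = Σ (A → ℕ) (Injective _≡_ _≡_)

-- Partial values ("expressions which may be undefined") are represented
-- as predicates  e : M → Set  where  e x  means "e is defined and equals x".
_≃ₚ_ : ∀ {m a b} {M : Set m} → (M → Set a) → (M → Set b) → Set (m ⊔ a ⊔ b)
e ≃ₚ e' = ∀ x → e x ⇔ e' x

_⊑ₚ_ : ∀ {m a b} {M : Set m} → (M → Set a) → (M → Set b) → Set (m ⊔ a ⊔ b)
e ⊑ₚ e' = ∀ x → e x → e' x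

Part : {A I : Set} → (A → I) → I → Set
Part {A} p i = Σ A (λ a → p a ≡ i)

-- Σ-monoid structure on a (nonempty) set M.  The partial operation Σ is
-- given by its graph: HasSum f x  means "the family f is summable with sum x".
record IsΣMonoid {ℓ : Level} (M : Set ℓ) : Set (lsuc ℓ) where
  field
    HasSum     : {A : Set} → (A → M) → M → Set ℓ
    sum-unique : {A : Set} (f : A → M) {x y : M} → HasSum f x → HasSum f y → x ≡ y
    nonempty   : M
    sum-single : {A : Set} (f : A → M) (a : A) → (∀ b → b ≡ a) → HasSum f (f a)
    sum-partition : {A I : Set} → IsCountable A → IsCountable I →
                    (p : A → I) (f : A → M) →
                    HasSum f ≃ₚ
                    (λ x → ∃ λ (s : I → M) →
                       (∀ i → HasSum (λ (u : Part p i) → f (proj₁ u)) (s i))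
                       × HasSum s x)

record Category (o ℓ : Level) : Set (lsuc (o ⊔ ℓ)) where
  infixr 9 _∘_
  field
    Obj  : Set o
    Hom  : Obj → Obj → Set ℓ
    id   : ∀ {X} → Hom X X
    _∘_  : ∀ {X Y Z} → Hom Y Z → Hom X Y → Hom X Z
    assoc     : ∀ {W X Y Z} (h : Hom Y Z) (g : Hom X Y) (f : Hom W X) →
                (h ∘ g) ∘ f ≡ h ∘ (g ∘ f)
    identityˡ : ∀ {X Y} (f : Hom X Y) → id ∘ f ≡ f
    identityʳ : ∀ {X Y} (f : Hom X Y) → f ∘ id ≡ f

record LeftΣAdditiveCategory (o ℓ : Level) : Set (lsuc (o ⊔ ℓ)) where
  field
    category : Category o ℓ
  open Category category public
  field
    homΣ : ∀ X Y → IsΣMonoid (Hom X Y)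
  HasSum : ∀ {X Y} {A : Set} → (A → Hom X Y) → Hom X Y → Set ℓ
  HasSum {X} {Y} = IsΣMonoid.HasSum (homΣ X Y)
  field
    left-additive : ∀ {X Y Z} {B : Set} → IsCountable B →
                    (g : B → Hom Y Z) (f : Hom X Y) →
                    (λ z → ∃ λ s → HasSum g s × z ≡ s ∘ f)
                      ⊑ₚ HasSum (λ b → g b ∘ f)

ΣAdditive : ∀ {o ℓ} (C : LeftΣAdditiveCategory o ℓ) →
            let open LeftΣAdditiveCategory C in
            ∀ {Y Z} → Hom Y Z → Set (o ⊔ lsuc lzero ⊔ ℓ)
ΣAdditive C {Y} {Z} h =
  ∀ (X : Obj) {A : Set} → IsCountable A → (f : A → Hom X Y) →
  (λ z → ∃ λ s → HasSum f s × z ≡ h ∘ s) ⊑ₚ HasSum (λ a → h ∘ f a)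
  where open LeftΣAdditiveCategory C

-- Σ_a (Σ_b h_b) ∘ f_a is obtained by summing the double family h_b ∘ f_a in two
-- orders. Summing each row over a gives h_b ∘ Σ_a f_a by Σ-additivity of h_b, and the
-- row sums add up to (Σ_b h_b) ∘ Σ_a f_a by left Σ-additivity; summing each column
-- over b gives (Σ_b h_b) ∘ f_a, again by left Σ-additivity. Partition associativity,
-- applied to the partitions of B × A into rows and into columns, equates the two.
module Submission where

open import Defs
open import Data.Empty using (⊥-elim)
open import Data.Nat using (ℕ; zero; suc; _*_)
open import Data.Nat.Properties using (*-cancelˡ-≡; even≢odd; suc-injective; eq?)
open import Data.Product using (Σ; ∃; _×_; _,_; proj₁; proj₂)
open import Data.Product.Properties using (Σ-≡,≡→≡)
open import Function using (Equivalence; mk⇔; mk↣)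
open import Relation.Binary.PropositionalEquality using (_≡_; refl; sym; subst; cong₂)
open import Axiom.UniquenessOfIdentityProofs using (UIP; module Decidable⇒UIP)

private
  variable
    A B I : Set

-- pair m n = 2 ^ m * (2 * n + 1)
pair : ℕ → ℕ → ℕ
pair zero    n = suc (2 * n)
pair (suc m) n = 2 * pair m n

pair-injective : ∀ m n m′ n′ → pair m n ≡ pair m′ n′ → m ≡ m′ × n ≡ n′
pair-injective zero    n zero     n′ eq = refl , *-cancelˡ-≡ n n′ 2 (suc-injective eq)
pair-injective zero    n (suc m′) n′ eq = ⊥-elim (even≢odd (pair m′ n′) n (sym eq))
pair-injective (suc m) n zero     n′ eq = ⊥-elim (even≢odd (pair m n) n′ eq)
pair-injective (suc m) n (suc m′) n′ eq
  with refl , refl ← pair-injective m n m′ n′ (*-cancelˡ-≡ _ _ 2 eq) = refl , refl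

isCountable-× : IsCountable A → IsCountable B → IsCountable (A × B)
isCountable-× (enumA , injA) (enumB , injB) =
  (λ (a , b) → pair (enumA a) (enumB b)) ,
  λ eq → let (a≡a′ , b≡b′) = pair-injective _ _ _ _ eq in
         cong₂ _,_ (injA a≡a′) (injB b≡b′)

isCountable⇒UIP : IsCountable I → UIP I
isCountable⇒UIP (enum , inj) = Decidable⇒UIP.≡-irrelevant (eq? (mk↣ inj))

isCountable-Part : IsCountable A → IsCountable I → (p : A → I) (i : I) →
                   IsCountable (Part p i)
isCountable-Part (enumA , injA) countableI p i =
  (λ u → enumA (proj₁ u)) , λ eq → Σ-≡,≡→≡ (injA eq , isCountable⇒UIP countableI _ _)

IsSingleton : Set → Set
IsSingleton A = Σ A λ centre → ∀ a → a ≡ centre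

row-fibre : (b : B) (a : A) →
            IsSingleton (Part (λ (u : Part {B × A} proj₁ b) → proj₂ (proj₁ u)) a)
row-fibre b a = (((b , a) , refl) , refl) , λ { (((.b , .a) , refl) , refl) → refl }

column-fibre : (a : A) (b : B) →
               IsSingleton (Part (λ (u : Part {B × A} proj₂ a) → proj₁ (proj₁ u)) b)
column-fibre a b = (((b , a) , refl) , refl) , λ { (((.b , .a) , refl) , refl) → refl }

module _ {ℓ} {M : Set ℓ} (ΣM : IsΣMonoid M) where
  open IsΣMonoid ΣM

  HasSum-cong : IsCountable I → {f g : I → M} → (∀ i → f i ≡ g i) →
                ∀ {x} → HasSum f x → HasSum g x
  HasSum-cong countableI {f} {g} f≗g {x} Σf=x =
    Equivalence.from (sum-partition countableI countableI (λ i → i) g x)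
      (f , singleton-sum , Σf=x)
    where
    singleton-sum : ∀ i → HasSum (λ (u : Part (λ j → j) i) → g (proj₁ u)) (f i)
    singleton-sum i = subst (HasSum _) (sym (f≗g i))
      (sum-single _ (i , refl) λ { (.i , refl) → refl })

  HasSum-reindex : IsCountable A → IsCountable I → (p : A → I) →
                   (fibre : ∀ i → IsSingleton (Part p i)) (f : A → M) →
                   HasSum f ≃ₚ HasSum (λ i → f (proj₁ (proj₁ (fibre i))))
  HasSum-reindex countableA countableI p fibre f x = mk⇔ to from
    where
    partition = sum-partition countableA countableI p f x

    fibre-sum : ∀ i → HasSum (λ (u : Part p i) → f (proj₁ u)) (f (proj₁ (proj₁ (fibre i))))
    fibre-sum i = sum-single _ (proj₁ (fibre i)) (proj₂ (fibre i))

    to : HasSum f x → HasSum (λ i → f (proj₁ (proj₁ (fibre i)))) x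
    to Σf=x = let (s , parts , Σs=x) = Equivalence.to partition Σf=x in
      HasSum-cong countableI (λ i → sum-unique _ (parts i) (fibre-sum i)) Σs=x

    from : HasSum (λ i → f (proj₁ (proj₁ (fibre i)))) x → HasSum f x
    from Σ=x = Equivalence.from partition (_ , fibre-sum , Σ=x)

  HasSum-fubini : IsCountable B → IsCountable A → (G : B × A → M) {r : B → M} {c : A → M} →
                  (∀ b → HasSum (λ a → G (b , a)) (r b)) →
                  (∀ a → HasSum (λ b → G (b , a)) (c a)) →
                  ∀ {x} → HasSum r x → HasSum c x
  HasSum-fubini countableB countableA G {r} {c} rows columns {x} Σr=x =
    HasSum-cong countableA column-sums Σcolumns=x
    where
    countableB×A = isCountable-× countableB countableA

    row-as-fibre : ∀ b → HasSum (λ (u : Part proj₁ b) → G (proj₁ u)) (r b)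
    row-as-fibre b = Equivalence.from
      (HasSum-reindex (isCountable-Part countableB×A countableB proj₁ b) countableA
        (λ u → proj₂ (proj₁ u)) (row-fibre b) (λ u → G (proj₁ u)) (r b))
      (rows b)

    ΣG=x : HasSum G x
    ΣG=x = Equivalence.from (sum-partition countableB×A countableB proj₁ G x)
      (r , row-as-fibre , Σr=x)

    by-columns : ∃ λ partial → (∀ a → HasSum (λ (u : Part proj₂ a) → G (proj₁ u)) (partial a))
                               × HasSum partial x
    by-columns = Equivalence.to (sum-partition countableB×A countableA proj₂ G x) ΣG=x

    partial = proj₁ by-columns
    Σcolumns=x = proj₂ (proj₂ by-columns)

    column-sums : ∀ a → partial a ≡ c a
    column-sums a = sum-unique _
      (Equivalence.to
        (HasSum-reindex (isCountable-Part countableB×A countableA proj₂ a) countableB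
          (λ u → proj₁ (proj₁ u)) (column-fibre a) (λ u → G (proj₁ u)) (partial a))
        (proj₁ (proj₂ by-columns) a))
      (columns a)

mainTheorem4 : ∀ {o ℓ} (C : LeftΣAdditiveCategory o ℓ) →
    let open LeftΣAdditiveCategory C in
    ∀ {Y Z : Obj} {B : Set} → IsCountable B →
    (h : B → Hom Y Z) (s : Hom Y Z) → HasSum h s →
    (∀ b → ΣAdditive C (h b)) →
    ΣAdditive C s
mainTheorem4 C {Z = Z} countableB h s Σh=s h-additive X countableA f _ (t , Σf=t , refl) =
  HasSum-fubini (homΣ X Z) countableB countableA (λ (b , a) → h b ∘ f a)
    (λ b → h-additive b X countableA f (h b ∘ t) (t , Σf=t , refl))
    (λ a → left-additive countableB h (f a) (s ∘ f a) (s , Σh=s , refl))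
    (left-additive countableB h t (s ∘ t) (s , Σh=s , refl))
  where open LeftΣAdditiveCategory C
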